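{- Let $M\ge 0$ be an integer. Define, for $n\ge 0$, $$\beta_n=\frac{1}{(q)_n(q)_{n+M}},$$ and $$\alpha_0=\frac{1}{(q)_M},\qquad \alpha_n=\frac{(q)_{M}(-1)^n(1+q^n)q^{n(3n-1)/2}}{(q)_{M-n}(q)_{M+n}}\quad (n>0).$$ Then $(\alpha_n,\beta_n)$ is a Bailey pair relative to $a=1$, i.e. for every $n\ge0$, $$\beta_n=\sum_{j=0}^{n}\frac{\alpha_j}{(q)_{n-j}(q)_{n+j}}.$$
   Context: Here $q$ is a complex number with $|q|<1$ (or a formal variable), $(q)_n=(q;q)_n=\prod_{i=1}^{n}(1-q^i)$ for $n\ge0$, with $(q)_0=1$, and $1/(q)_m$ is interpreted as $0$ for negative integers $m$ (so $\alpha_n=0$ for $n>M$). -}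

module Defs where

open import Data.Nat as ℕ using (ℕ; zero; suc; _∸_)
open import Data.Nat.DivMod using (_/_)
open import Data.Nat.Divisibility using (_∣?_)
open import Data.Integer as ℤ using (ℤ; +_; -[1+_])
open import Relation.Nullary using (yes; no)

-- Formal power series in q over ℤ, given by their coefficient sequences.
PS : Set
PS = ℕ → ℤ

0ᵖ : PS
0ᵖ _ = ℤ.0ℤ

1ᵖ : PS
1ᵖ zero    = ℤ.1ℤ
1ᵖ (suc _) = ℤ.0ℤ

qpow : ℕ → PS
qpow e k with e ℕ.≟ k
... | yes _ = ℤ.1ℤ
... | no  _ = ℤ.0ℤ

infixl 6 _+ᵖ_ _-ᵖ_
infixl 7 _*ᵖ_ _·ᵖ_

_+ᵖ_ : PS → PS → PS
(f +ᵖ g) k = f k ℤ.+ g k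

_-ᵖ_ : PS → PS → PS
(f -ᵖ g) k = f k ℤ.- g k

_·ᵖ_ : ℤ → PS → PS
(c ·ᵖ f) k = c ℤ.* f k

sumTo : ℕ → (ℕ → ℤ) → ℤ
sumTo zero    h = h zero
sumTo (suc k) h = sumTo k h ℤ.+ h (suc k)

_*ᵖ_ : PS → PS → PS
(f *ᵖ g) k = sumTo k (λ i → f i ℤ.* g (k ∸ i))

sumPS : ℕ → (ℕ → PS) → PS
sumPS zero    F = F zero
sumPS (suc n) F = sumPS n F +ᵖ F (suc n)

poch : ℕ → PS
poch zero    = 1ᵖ
poch (suc n) = poch n *ᵖ (1ᵖ -ᵖ qpow (suc n))

-- 1/(1 - q^(suc j)) = Σ_{m≥0} q^{(suc j) m}
geom : ℕ → PS
geom j k with suc j ∣? k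
... | yes _ = ℤ.1ℤ
... | no  _ = ℤ.0ℤ

invPoch : ℕ → PS
invPoch zero    = 1ᵖ
invPoch (suc n) = invPoch n *ᵖ geom n

-- 1/(q)_m for an integer m, with 1/(q)_m = 0 for m < 0
recipPoch : ℤ → PS
recipPoch (+ m)    = invPoch m
recipPoch -[1+ _ ] = 0ᵖ

β : ℕ → ℕ → PS
β M n = invPoch n *ᵖ invPoch (n ℕ.+ M)

α : ℕ → ℕ → PS
α M zero    = invPoch M
α M (suc m) =
  ((ℤ.- ℤ.1ℤ) ℤ.^ n) ·ᵖ
    (poch M *ᵖ (1ᵖ +ᵖ qpow n) *ᵖ qpow ((n ℕ.* (3 ℕ.* n ∸ 1)) / 2)
      *ᵖ recipPoch (+ M ℤ.- + n) *ᵖ invPoch (M ℕ.+ n))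
  where n = suc m

baileyRHS : ℕ → ℕ → PS
baileyRHS M n = sumPS n (λ j → α M j *ᵖ recipPoch (+ n ℤ.- + j) *ᵖ invPoch (n ℕ.+ j))

-- Writing α_j = (q)_M w_j / ((q)_{M-j} (q)_{M+j}), with w_0 = 1 and
-- w_j = (-1)^j (1 + q^j) q^{j(3j-1)/2}, the Bailey relation is (q)_M times
--   S(M, n) := Σ_{j=0}^{n} w_j / ((q)_{M-j} (q)_{M+j} (q)_{n-j} (q)_{n+j}) = 1/((q)_M (q)_n (q)_{M+n}).
-- For fixed m and n, the j-th summand of S(m, n) - (1 - q^{m+1})(1 - q^{m+n+1}) S(m+1, n)
-- is q^{m+1} (Γ_{j+1} - Γ_j), where Γ_0 = 0 and
--   Γ_{i+1} = (-1)^{i+1} q^{3i(i+1)/2} / ((q)_{m-i} (q)_{m+i+1} (q)_{n-i-1} (q)_{n+i}).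
-- As Γ_{n+1} = 0, the sum telescopes to 0; so S(m, n) = (1 - q^{m+1})(1 - q^{m+n+1}) S(m+1, n),
-- and induction on M from S(0, n) = 1/(q)_n^2 gives the closed form.
module Submission where

open import Defs
open import Data.Nat using (ℕ; zero; suc; _∸_; _≤_; _<_; z≤n; s≤s)
import Data.Nat as ℕ
import Data.Nat.Properties as ℕP
open import Data.Nat.DivMod using (_/_; m*n/n≡m)
open import Data.Nat.Divisibility using (_∣_; _∣?_; _∣0; ∣-refl; ∣m∣n⇒∣m+n; ∣m+n∣m⇒∣n; >⇒∤)
import Data.Nat.Tactic.RingSolver as ℕ-Solver
open import Data.Integer as ℤ using (ℤ; +_; -[1+_])
import Data.Integer.Properties as ℤP
open import Algebra.Bundles using (CommutativeRing)
import Algebra.Solver.Ring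
import Relation.Binary.Reasoning.Setoid
import Algebra.Solver.Ring.AlmostCommutativeRing as ACR
open import Algebra.Properties.CommutativeSemigroup ℤP.+-commutativeSemigroup using (interchange)
open import Data.Empty using (⊥-elim)
open import Data.List using ([]; _∷_)
open import Data.Maybe using (Maybe; just; nothing)
open import Data.Product using (_,_)
open import Data.Sum using (_⊎_; inj₁; inj₂)
open import Level using (0ℓ)
open import Relation.Binary.PropositionalEquality
open import Relation.Binary.Structures using (IsEquivalence)
open import Relation.Nullary using (¬_; yes; no)

-- Finite sums of integers

sumTo-cong : ∀ k {g h : ℕ → ℤ} → (∀ i → i ≤ k → g i ≡ h i) → sumTo k g ≡ sumTo k h
sumTo-cong zero    eq = eq 0 z≤n
sumTo-cong (suc k) eq =
  cong₂ ℤ._+_ (sumTo-cong k (λ i i≤k → eq i (ℕP.m≤n⇒m≤1+n i≤k))) (eq (suc k) ℕP.≤-refl)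

sumTo-+ : ∀ k (g h : ℕ → ℤ) → sumTo k (λ i → g i ℤ.+ h i) ≡ sumTo k g ℤ.+ sumTo k h
sumTo-+ zero    g h = refl
sumTo-+ (suc k) g h rewrite sumTo-+ k g h = interchange (sumTo k g) (sumTo k h) (g (suc k)) (h (suc k))

sumTo-*ˡ : ∀ k c (h : ℕ → ℤ) → c ℤ.* sumTo k h ≡ sumTo k (λ i → c ℤ.* h i)
sumTo-*ˡ zero    c h = refl
sumTo-*ˡ (suc k) c h rewrite sym (sumTo-*ˡ k c h) = ℤP.*-distribˡ-+ c (sumTo k h) (h (suc k))

sumTo-*ʳ : ∀ k c (h : ℕ → ℤ) → sumTo k h ℤ.* c ≡ sumTo k (λ i → h i ℤ.* c)
sumTo-*ʳ k c h = begin
  sumTo k h ℤ.* c              ≡⟨ ℤP.*-comm (sumTo k h) c ⟩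
  c ℤ.* sumTo k h              ≡⟨ sumTo-*ˡ k c h ⟩
  sumTo k (λ i → c ℤ.* h i)    ≡⟨ sumTo-cong k (λ i _ → ℤP.*-comm c (h i)) ⟩
  sumTo k (λ i → h i ℤ.* c)    ∎
  where open ≡-Reasoning

sumTo-suc : ∀ k (h : ℕ → ℤ) → sumTo (suc k) h ≡ h 0 ℤ.+ sumTo k (λ i → h (suc i))
sumTo-suc zero    h = refl
sumTo-suc (suc k) h rewrite sumTo-suc k h = ℤP.+-assoc (h 0) _ _

sumTo-reverse : ∀ k (h : ℕ → ℤ) → sumTo k h ≡ sumTo k (λ i → h (k ∸ i))
sumTo-reverse zero    h = refl
sumTo-reverse (suc k) h = begin
  sumTo k h ℤ.+ h (suc k)                            ≡⟨ cong (ℤ._+ h (suc k)) (sumTo-reverse k h) ⟩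
  sumTo k (λ i → h (k ∸ i)) ℤ.+ h (suc k)            ≡⟨ ℤP.+-comm _ (h (suc k)) ⟩
  h (suc k) ℤ.+ sumTo k (λ i → h (suc k ∸ suc i))    ≡⟨ sym (sumTo-suc k (λ i → h (suc k ∸ i))) ⟩
  sumTo (suc k) (λ i → h (suc k ∸ i))                ∎
  where open ≡-Reasoning

sumTo-head : ∀ k (h : ℕ → ℤ) → (∀ i → h (suc i) ≡ ℤ.0ℤ) → sumTo k h ≡ h 0
sumTo-head zero    h h-tail = refl
sumTo-head (suc k) h h-tail rewrite sumTo-head k h h-tail | h-tail k = ℤP.+-identityʳ (h 0)

sumTo-zero : ∀ k (h : ℕ → ℤ) → (∀ i → i ≤ k → h i ≡ ℤ.0ℤ) → sumTo k h ≡ ℤ.0ℤ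
sumTo-zero k h h≡0 = trans (sumTo-cong k h≡0) (sumTo-head k (λ _ → ℤ.0ℤ) (λ _ → refl))

sumTo-triangle : ∀ k (X : ℕ → ℕ → ℤ) →
  sumTo k (λ i → sumTo i (λ a → X a i)) ≡ sumTo k (λ a → sumTo (k ∸ a) (λ b → X a (a ℕ.+ b)))
sumTo-triangle zero    X = refl
sumTo-triangle (suc k) X = begin
    sumTo k (λ i → sumTo i (λ a → X a i)) ℤ.+ (column ℤ.+ corner)
  ≡⟨ cong (ℤ._+ (column ℤ.+ corner)) (sumTo-triangle k X) ⟩
    rows k k ℤ.+ (column ℤ.+ corner)
  ≡⟨ sym (ℤP.+-assoc (rows k k) column corner) ⟩
    rows k k ℤ.+ column ℤ.+ corner
  ≡⟨ cong₂ ℤ._+_ (trans (sym (sumTo-+ k _ _)) (sumTo-cong k extend-row))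
                 (cong (X (suc k)) (sym (ℕP.+-identityʳ (suc k)))) ⟩
    rows k (suc k) ℤ.+ X (suc k) (suc k ℕ.+ 0)
  ≡⟨ cong (λ t → rows k (suc k) ℤ.+ sumTo t (λ b → X (suc k) (suc k ℕ.+ b))) (sym (ℕP.n∸n≡0 k)) ⟩
    rows (suc k) (suc k)
  ∎
  where
  open ≡-Reasoning
  rows : ℕ → ℕ → ℤ
  rows t s = sumTo t (λ a → sumTo (s ∸ a) (λ b → X a (a ℕ.+ b)))
  column corner : ℤ
  column = sumTo k (λ a → X a (suc k))
  corner = X (suc k) (suc k)
  extend-row : ∀ a → a ≤ k →
    sumTo (k ∸ a) (λ b → X a (a ℕ.+ b)) ℤ.+ X a (suc k) ≡ sumTo (suc k ∸ a) (λ b → X a (a ℕ.+ b))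
  extend-row a a≤k rewrite ℕP.+-∸-assoc 1 a≤k =
    cong (λ t → sumTo (k ∸ a) (λ b → X a (a ℕ.+ b)) ℤ.+ X a t)
         (trans (cong suc (sym (ℕP.m+[n∸m]≡n a≤k))) (sym (ℕP.+-suc a (k ∸ a))))

-- The commutative ring of power series

infix 4 _≈ᵖ_

-- A record rather than a function type, so that both series can be inferred
-- from a proof.
record _≈ᵖ_ (f g : PS) : Set where
  constructor coeffwise
  field coeff : ∀ k → f k ≡ g k
open _≈ᵖ_

negᵖ : PS → PS
negᵖ f k = ℤ.- f k

≈ᵖ-isEquivalence : IsEquivalence _≈ᵖ_
≈ᵖ-isEquivalence = record
  { refl  = coeffwise λ _ → refl
  ; sym   = λ f≈g → coeffwise λ k → sym (coeff f≈g k)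
  ; trans = λ f≈g g≈h → coeffwise λ k → trans (coeff f≈g k) (coeff g≈h k)
  }

*ᵖ-cong : ∀ {f f′ g g′} → f ≈ᵖ f′ → g ≈ᵖ g′ → f *ᵖ g ≈ᵖ f′ *ᵖ g′
*ᵖ-cong f≈f′ g≈g′ = coeffwise λ k →
  sumTo-cong k (λ i _ → cong₂ ℤ._*_ (coeff f≈f′ i) (coeff g≈g′ (k ∸ i)))

*ᵖ-comm : ∀ f g → f *ᵖ g ≈ᵖ g *ᵖ f
*ᵖ-comm f g = coeffwise λ k → trans (sumTo-reverse k _) (sumTo-cong k (λ i i≤k →
  trans (cong (λ t → f (k ∸ i) ℤ.* g t) (ℕP.m∸[m∸n]≡n i≤k)) (ℤP.*-comm (f (k ∸ i)) (g i))))

*ᵖ-assoc : ∀ f g h → (f *ᵖ g) *ᵖ h ≈ᵖ f *ᵖ (g *ᵖ h)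
*ᵖ-assoc f g h = coeffwise λ k → begin
    sumTo k (λ i → sumTo i (λ a → f a ℤ.* g (i ∸ a)) ℤ.* h (k ∸ i))
  ≡⟨ sumTo-cong k (λ i _ → sumTo-*ʳ i (h (k ∸ i)) _) ⟩
    sumTo k (λ i → sumTo i (λ a → f a ℤ.* g (i ∸ a) ℤ.* h (k ∸ i)))
  ≡⟨ sumTo-triangle k (λ a i → f a ℤ.* g (i ∸ a) ℤ.* h (k ∸ i)) ⟩
    sumTo k (λ a → sumTo (k ∸ a) (λ b → f a ℤ.* g (a ℕ.+ b ∸ a) ℤ.* h (k ∸ (a ℕ.+ b))))
  ≡⟨ sumTo-cong k (λ a _ → trans (sumTo-cong (k ∸ a) (λ b _ → reindex k a b))
                                 (sym (sumTo-*ˡ (k ∸ a) (f a) _))) ⟩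
    sumTo k (λ a → f a ℤ.* sumTo (k ∸ a) (λ b → g b ℤ.* h (k ∸ a ∸ b)))
  ∎
  where
  open ≡-Reasoning
  reindex : ∀ k a b →
    f a ℤ.* g (a ℕ.+ b ∸ a) ℤ.* h (k ∸ (a ℕ.+ b)) ≡ f a ℤ.* (g b ℤ.* h (k ∸ a ∸ b))
  reindex k a b rewrite ℕP.m+n∸m≡n a b | sym (ℕP.∸-+-assoc k a b) = ℤP.*-assoc (f a) (g b) _

*ᵖ-distribˡ-+ᵖ : ∀ f g h → f *ᵖ (g +ᵖ h) ≈ᵖ f *ᵖ g +ᵖ f *ᵖ h
*ᵖ-distribˡ-+ᵖ f g h = coeffwise λ k →
  trans (sumTo-cong k (λ i _ → ℤP.*-distribˡ-+ (f i) (g (k ∸ i)) (h (k ∸ i)))) (sumTo-+ k _ _)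

*ᵖ-identityˡ : ∀ f → 1ᵖ *ᵖ f ≈ᵖ f
*ᵖ-identityˡ f = coeffwise λ k → trans (sumTo-head k _ (λ _ → refl)) (ℤP.*-identityˡ (f k))

PS-commutativeRing : CommutativeRing 0ℓ 0ℓ
PS-commutativeRing = record
  { Carrier = PS ; _≈_ = _≈ᵖ_ ; _+_ = _+ᵖ_ ; _*_ = _*ᵖ_ ; -_ = negᵖ ; 0# = 0ᵖ ; 1# = 1ᵖ
  ; isCommutativeRing = record
    { isRing = record
      { +-isAbelianGroup = record
        { isGroup = record
          { isMonoid = record
            { isSemigroup = record
              { isMagma = record
                { isEquivalence = ≈ᵖ-isEquivalence
                ; ∙-cong = λ f≈f′ g≈g′ → coeffwise λ k →
                    cong₂ ℤ._+_ (coeff f≈f′ k) (coeff g≈g′ k) }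
              ; assoc = λ f g h → coeffwise λ k → ℤP.+-assoc (f k) (g k) (h k) }
            ; identity = (λ f → coeffwise λ k → ℤP.+-identityˡ (f k))
                       , (λ f → coeffwise λ k → ℤP.+-identityʳ (f k)) }
          ; inverse = (λ f → coeffwise λ k → ℤP.+-inverseˡ (f k))
                    , (λ f → coeffwise λ k → ℤP.+-inverseʳ (f k))
          ; ⁻¹-cong = λ f≈g → coeffwise λ k → cong ℤ.-_ (coeff f≈g k) }
        ; comm = λ f g → coeffwise λ k → ℤP.+-comm (f k) (g k) }
      ; *-cong = *ᵖ-cong
      ; *-assoc = *ᵖ-assoc
      ; *-identity = *ᵖ-identityˡ , (λ f → trans′ (*ᵖ-comm f 1ᵖ) (*ᵖ-identityˡ f))
      ; distrib = *ᵖ-distribˡ-+ᵖ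
                , (λ f g h → trans′ (*ᵖ-comm (g +ᵖ h) f)
                    (trans′ (*ᵖ-distribˡ-+ᵖ f g h) (coeffwise λ k →
                      cong₂ ℤ._+_ (coeff (*ᵖ-comm f g) k) (coeff (*ᵖ-comm f h) k)))) }
    ; *-comm = *ᵖ-comm } }
  where trans′ = IsEquivalence.trans ≈ᵖ-isEquivalence

open CommutativeRing PS-commutativeRing
  using (+-cong; -‿cong; *-cong; *-identityˡ; *-identityʳ; zeroˡ; zeroʳ)
  renaming (refl to ≈-refl; sym to ≈-sym; trans to ≈-trans)

-- Defined by cases so that the solver's constants 0 and 1 are literally 0ᵖ and 1ᵖ.
const : ℤ → PS
const (+ 0) = 0ᵖ
const (+ 1) = 1ᵖ
const c     = c ·ᵖ 1ᵖ

const≈·ᵖ1ᵖ : ∀ c → const c ≈ᵖ c ·ᵖ 1ᵖ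
const≈·ᵖ1ᵖ (+ 0)        = coeffwise λ k → sym (ℤP.*-zeroˡ (1ᵖ k))
const≈·ᵖ1ᵖ (+ 1)        = coeffwise λ k → sym (ℤP.*-identityˡ (1ᵖ k))
const≈·ᵖ1ᵖ (+ suc (suc n)) = ≈-refl
const≈·ᵖ1ᵖ -[1+ n ]     = ≈-refl

·ᵖ≈const*ᵖ : ∀ c f → c ·ᵖ f ≈ᵖ const c *ᵖ f
·ᵖ≈const*ᵖ c f = ≈-trans
  (coeffwise λ k → sym (trans (sumTo-head k _ (λ i → cong (ℤ._* f (k ∸ suc i)) (ℤP.*-zeroʳ c)))
                              (cong (ℤ._* f k) (ℤP.*-identityʳ c))))
  (*ᵖ-cong (≈-sym (const≈·ᵖ1ᵖ c)) ≈-refl)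

const-+ : ∀ a b → const (a ℤ.+ b) ≈ᵖ const a +ᵖ const b
const-+ a b = ≈-trans (const≈·ᵖ1ᵖ (a ℤ.+ b))
  (≈-trans (coeffwise λ k → ℤP.*-distribʳ-+ (1ᵖ k) a b)
    (+-cong (≈-sym (const≈·ᵖ1ᵖ a)) (≈-sym (const≈·ᵖ1ᵖ b))))

const-* : ∀ a b → const (a ℤ.* b) ≈ᵖ const a *ᵖ const b
const-* a b = ≈-trans (const≈·ᵖ1ᵖ (a ℤ.* b))
  (≈-trans (coeffwise λ k → ℤP.*-assoc a b (1ᵖ k))
    (≈-trans (·ᵖ≈const*ᵖ a (b ·ᵖ 1ᵖ)) (*ᵖ-cong (≈-refl {const a}) (≈-sym (const≈·ᵖ1ᵖ b)))))

const-neg : ∀ a → const (ℤ.- a) ≈ᵖ negᵖ (const a)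
const-neg a = ≈-trans (const≈·ᵖ1ᵖ (ℤ.- a))
  (≈-trans (coeffwise λ k → sym (ℤP.neg-distribˡ-* a (1ᵖ k))) (-‿cong (≈-sym (const≈·ᵖ1ᵖ a))))

const-morphism : CommutativeRing.rawRing ℤP.+-*-commutativeRing ACR.-Raw-AlmostCommutative⟶
                 ACR.fromCommutativeRing PS-commutativeRing
const-morphism = record
  { ⟦_⟧    = const
  ; +-homo = const-+
  ; *-homo = const-*
  ; -‿homo = const-neg
  ; 0-homo = ≈-refl
  ; 1-homo = ≈-refl
  }

const-≟ : ∀ a b → Maybe (const a ≈ᵖ const b)
const-≟ a b with a ℤ.≟ b
... | yes refl = just ≈-refl
... | no  _    = nothing

module PS-Solver = Algebra.Solver.Ring (CommutativeRing.rawRing ℤP.+-*-commutativeRing)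
  (ACR.fromCommutativeRing PS-commutativeRing) const-morphism const-≟
open PS-Solver using (Polynomial; solve; _:=_; _:+_; _:*_; _:-_; :-_; con)

:0 :1 : ∀ {k} → Polynomial k
:0 = con (+ 0)
:1 = con ℤ.1ℤ

module PS-Reasoning = Relation.Binary.Reasoning.Setoid (CommutativeRing.setoid PS-commutativeRing)

≡⇒≈ᵖ : ∀ {f g} → f ≡ g → f ≈ᵖ g
≡⇒≈ᵖ refl = ≈-refl

-ᵖ-cong : ∀ {f f′ g g′} → f ≈ᵖ f′ → g ≈ᵖ g′ → f -ᵖ g ≈ᵖ f′ -ᵖ g′
-ᵖ-cong f≈f′ g≈g′ = +-cong f≈f′ (-‿cong g≈g′)

-ᵖ≈0ᵖ⇒≈ᵖ : ∀ {f g} → f -ᵖ g ≈ᵖ 0ᵖ → f ≈ᵖ g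
-ᵖ≈0ᵖ⇒≈ᵖ {f} {g} f-g≈0 = coeffwise λ k → ℤP.i-j≡0⇒i≡j (f k) (g k) (coeff f-g≈0 k)

1ᵖ-ᵖ-cong : ∀ {f g} → f ≈ᵖ g → 1ᵖ -ᵖ f ≈ᵖ 1ᵖ -ᵖ g
1ᵖ-ᵖ-cong = -ᵖ-cong (≈-refl {1ᵖ})

vanishing-*ᵖˡ : ∀ {f} g → f ≈ᵖ 0ᵖ → f *ᵖ g ≈ᵖ 0ᵖ
vanishing-*ᵖˡ g f≈0 = ≈-trans (*-cong f≈0 (≈-refl {g})) (zeroˡ g)

vanishing-*ᵖʳ : ∀ f {g} → g ≈ᵖ 0ᵖ → f *ᵖ g ≈ᵖ 0ᵖ
vanishing-*ᵖʳ f g≈0 = ≈-trans (*-cong (≈-refl {f}) g≈0) (zeroʳ f)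

vanishing-·ᵖ : ∀ c {f} → f ≈ᵖ 0ᵖ → c ·ᵖ f ≈ᵖ 0ᵖ
vanishing-·ᵖ c f≈0 = coeffwise λ k → trans (cong (c ℤ.*_) (coeff f≈0 k)) (ℤP.*-zeroʳ c)

-- Finite sums of power series

sumPS-cong : ∀ n {F G : ℕ → PS} → (∀ j → j ≤ n → F j ≈ᵖ G j) → sumPS n F ≈ᵖ sumPS n G
sumPS-cong zero    F≈G = F≈G 0 z≤n
sumPS-cong (suc n) F≈G =
  +-cong (sumPS-cong n (λ j j≤n → F≈G j (ℕP.m≤n⇒m≤1+n j≤n))) (F≈G (suc n) ℕP.≤-refl)

sumPS-*ˡ : ∀ n X (F : ℕ → PS) → sumPS n (λ j → X *ᵖ F j) ≈ᵖ X *ᵖ sumPS n F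
sumPS-*ˡ zero    X F = ≈-refl
sumPS-*ˡ (suc n) X F = ≈-trans (+-cong (sumPS-*ˡ n X F) ≈-refl)
  (solve 3 (λ x s f → x :* s :+ x :* f := x :* (s :+ f)) ≈-refl X (sumPS n F) (F (suc n)))

sumPS-linear : ∀ n X (F G : ℕ → PS) → sumPS n (λ j → F j -ᵖ X *ᵖ G j) ≈ᵖ sumPS n F -ᵖ X *ᵖ sumPS n G
sumPS-linear zero    X F G = ≈-refl
sumPS-linear (suc n) X F G = ≈-trans (+-cong (sumPS-linear n X F G) ≈-refl)
  (solve 5 (λ x s t f g → (s :- x :* t) :+ (f :- x :* g) := (s :+ f) :- x :* (t :+ g))
         ≈-refl X (sumPS n F) (sumPS n G) (F (suc n)) (G (suc n)))

sumPS-telescoping : ∀ n X (Γ : ℕ → PS) →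
  sumPS n (λ j → X *ᵖ (Γ (suc j) -ᵖ Γ j)) ≈ᵖ X *ᵖ (Γ (suc n) -ᵖ Γ 0)
sumPS-telescoping zero    X Γ = ≈-refl
sumPS-telescoping (suc n) X Γ = ≈-trans (+-cong (sumPS-telescoping n X Γ) ≈-refl)
  (solve 4 (λ x a b c → x :* (b :- a) :+ x :* (c :- b) := x :* (c :- a))
         ≈-refl X (Γ 0) (Γ (suc n)) (Γ (suc (suc n))))

sumPS-head : ∀ n (F : ℕ → PS) → (∀ i → F (suc i) ≈ᵖ 0ᵖ) → sumPS n F ≈ᵖ F 0
sumPS-head zero    F F-tail = ≈-refl
sumPS-head (suc n) F F-tail =
  ≈-trans (+-cong (sumPS-head n F F-tail) (F-tail n)) (coeffwise λ k → ℤP.+-identityʳ (F 0 k))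

qpow-≡ : ∀ {e k} → e ≡ k → qpow e k ≡ ℤ.1ℤ
qpow-≡ {e} {k} e≡k with e ℕ.≟ k
... | yes _   = refl
... | no  e≢k = ⊥-elim (e≢k e≡k)

qpow-≢ : ∀ {e k} → ¬ e ≡ k → qpow e k ≡ ℤ.0ℤ
qpow-≢ {e} {k} e≢k with e ℕ.≟ k
... | yes e≡k = ⊥-elim (e≢k e≡k)
... | no  _   = refl

sumTo-qpow-*-> : ∀ k e (h : ℕ → ℤ) → k < e → sumTo k (λ i → qpow e i ℤ.* h i) ≡ ℤ.0ℤ
sumTo-qpow-*-> k e h k<e = sumTo-zero k _ (λ i i≤k → cong (ℤ._* h i)
  (qpow-≢ (λ e≡i → ℕP.<⇒≱ k<e (subst (_≤ k) (sym e≡i) i≤k))))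

sumTo-qpow-* : ∀ k e (h : ℕ → ℤ) → e ≤ k → sumTo k (λ i → qpow e i ℤ.* h i) ≡ h e
sumTo-qpow-* zero    .zero h z≤n = ℤP.*-identityˡ (h 0)
sumTo-qpow-* (suc k) e     h e≤1+k with ℕP.m≤n⇒m<n∨m≡n e≤1+k
... | inj₁ e<1+k = trans
  (cong₂ ℤ._+_ (sumTo-qpow-* k e h (ℕP.≤-pred e<1+k))
               (cong (ℤ._* h (suc k)) (qpow-≢ (ℕP.<⇒≢ e<1+k))))
  (ℤP.+-identityʳ (h e))
... | inj₂ refl = trans
  (cong₂ ℤ._+_ (sumTo-qpow-*-> k (suc k) h ℕP.≤-refl) (cong (ℤ._* h (suc k)) (qpow-≡ {suc k} refl)))
  (trans (ℤP.+-identityˡ _) (ℤP.*-identityˡ (h (suc k))))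

qpow-*ᵖ-≤ : ∀ e g k → e ≤ k → (qpow e *ᵖ g) k ≡ g (k ∸ e)
qpow-*ᵖ-≤ e g k = sumTo-qpow-* k e (λ i → g (k ∸ i))

qpow-*ᵖ-> : ∀ e g k → k < e → (qpow e *ᵖ g) k ≡ ℤ.0ℤ
qpow-*ᵖ-> e g k = sumTo-qpow-*-> k e (λ i → g (k ∸ i))

qpow-+ : ∀ a b → qpow (a ℕ.+ b) ≈ᵖ qpow a *ᵖ qpow b
qpow-+ a b = coeffwise coeff-+
  where
  coeff-+ : ∀ k → qpow (a ℕ.+ b) k ≡ (qpow a *ᵖ qpow b) k
  coeff-+ k with a ℕ.≤? k
  ... | no a≰k = trans (qpow-≢ (λ a+b≡k → a≰k (subst (a ≤_) a+b≡k (ℕP.m≤m+n a b))))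
                       (sym (qpow-*ᵖ-> a (qpow b) k (ℕP.≰⇒> a≰k)))
  ... | yes a≤k with b ℕ.≟ k ∸ a
  ...   | yes b≡k-a = trans (qpow-≡ (trans (cong (a ℕ.+_) b≡k-a) (ℕP.m+[n∸m]≡n a≤k)))
                            (sym (trans (qpow-*ᵖ-≤ a (qpow b) k a≤k) (qpow-≡ b≡k-a)))
  ...   | no  b≢k-a = trans (qpow-≢ (λ a+b≡k → b≢k-a (trans (sym (ℕP.m+n∸m≡n a b)) (cong (_∸ a) a+b≡k))))
                            (sym (trans (qpow-*ᵖ-≤ a (qpow b) k a≤k) (qpow-≢ b≢k-a)))

qpow-split : ∀ {c} a b → c ≡ a ℕ.+ b → qpow c ≈ᵖ qpow a *ᵖ qpow b
qpow-split a b refl = qpow-+ a b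

qpow-3* : ∀ e → qpow (3 ℕ.* e) ≈ᵖ qpow e *ᵖ (qpow e *ᵖ qpow e)
qpow-3* e = ≈-trans (qpow-+ e (e ℕ.+ (e ℕ.+ 0)))
  (*-cong (≈-refl {qpow e}) (qpow-split e e (cong (e ℕ.+_) (ℕP.+-identityʳ e))))

qpow0≈1ᵖ : qpow 0 ≈ᵖ 1ᵖ
qpow0≈1ᵖ = coeffwise λ { zero → refl ; (suc k) → refl }

1ᵖ-qpow0≈0ᵖ : 1ᵖ -ᵖ qpow 0 ≈ᵖ 0ᵖ
1ᵖ-qpow0≈0ᵖ = ≈-trans (1ᵖ-ᵖ-cong qpow0≈1ᵖ) (coeffwise λ k → ℤP.+-inverseʳ (1ᵖ k))

-- Geometric series and q-Pochhammer symbols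

geom-∣ : ∀ j k → suc j ∣ k → geom j k ≡ ℤ.1ℤ
geom-∣ j k d with suc j ∣? k
... | yes _ = refl
... | no ¬d = ⊥-elim (¬d d)

geom-∤ : ∀ j k → ¬ suc j ∣ k → geom j k ≡ ℤ.0ℤ
geom-∤ j k ¬d with suc j ∣? k
... | yes d = ⊥-elim (¬d d)
... | no  _ = refl

geom-periodic : ∀ j x → geom j (x ℕ.+ suc j) ≡ geom j x
geom-periodic j x with suc j ∣? x
... | yes d = geom-∣ j _ (∣m∣n⇒∣m+n d ∣-refl)
... | no ¬d = geom-∤ j _ (λ d → ¬d (∣m+n∣m⇒∣n (subst (suc j ∣_) (ℕP.+-comm x (suc j)) d) ∣-refl))

geom-*ᵖ-1-qpow : ∀ j → geom j *ᵖ (1ᵖ -ᵖ qpow (suc j)) ≈ᵖ 1ᵖ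
geom-*ᵖ-1-qpow j =
  ≈-trans (solve 2 (λ g y → g :* (:1 :- y) := g :- y :* g) ≈-refl (geom j) (qpow (suc j)))
        (coeffwise coeff-1)
  where
  coeff-1 : ∀ k → geom j k ℤ.- (qpow (suc j) *ᵖ geom j) k ≡ 1ᵖ k
  coeff-1 zero = cong₂ ℤ._-_ (geom-∣ j 0 (suc j ∣0)) (qpow-*ᵖ-> (suc j) (geom j) 0 (s≤s z≤n))
  coeff-1 (suc k) with suc j ℕ.≤? suc k
  ... | yes j<k = trans
    (cong₂ ℤ._-_ (trans (cong (geom j) (sym (ℕP.m∸n+n≡m j<k))) (geom-periodic j (suc k ∸ suc j)))
                 (qpow-*ᵖ-≤ (suc j) (geom j) (suc k) j<k))
    (ℤP.+-inverseʳ (geom j (suc k ∸ suc j)))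
  ... | no  j≮k = cong₂ ℤ._-_ (geom-∤ j (suc k) (>⇒∤ (ℕP.≰⇒> j≮k)))
                              (qpow-*ᵖ-> (suc j) (geom j) (suc k) (ℕP.≰⇒> j≮k))

invPoch-pred : ∀ {a} b → suc a ≡ b → invPoch a ≈ᵖ invPoch b *ᵖ (1ᵖ -ᵖ qpow b)
invPoch-pred {a} _ refl = ≈-sym (≈-trans (*ᵖ-assoc (invPoch a) (geom a) (1ᵖ -ᵖ qpow (suc a)))
  (≈-trans (*-cong (≈-refl {invPoch a}) (geom-*ᵖ-1-qpow a)) (*-identityʳ (invPoch a))))

poch-*ᵖ-invPoch : ∀ n → poch n *ᵖ invPoch n ≈ᵖ 1ᵖ
poch-*ᵖ-invPoch zero    = *-identityʳ 1ᵖ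
poch-*ᵖ-invPoch (suc n) = ≈-trans
  (solve 4 (λ p d i g → (p :* d) :* (i :* g) := (p :* i) :* (g :* d))
         ≈-refl (poch n) (1ᵖ -ᵖ qpow (suc n)) (invPoch n) (geom n))
  (≈-trans (*-cong (poch-*ᵖ-invPoch n) (geom-*ᵖ-1-qpow n)) (*-identityʳ 1ᵖ))

poch-invPoch-cancel : ∀ M f → poch M *ᵖ (invPoch M *ᵖ f) ≈ᵖ f
poch-invPoch-cancel M f = ≈-trans (≈-sym (*ᵖ-assoc (poch M) (invPoch M) f))
  (≈-trans (*-cong (poch-*ᵖ-invPoch M) (≈-refl {f})) (*-identityˡ f))

invPochSub : ℕ → ℕ → PS
invPochSub a b = recipPoch (+ a ℤ.- + b)

invPochSub-≤ : ∀ {a b} → b ≤ a → invPochSub a b ≡ invPoch (a ∸ b)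
invPochSub-≤ {a} {b} b≤a = cong recipPoch (trans (ℤP.m-n≡m⊖n a b) (ℤP.⊖-≥ b≤a))

invPochSub-> : ∀ {a b} → a < b → invPochSub a b ≡ 0ᵖ
invPochSub-> {a} {b} a<b = cong recipPoch
  (trans (ℤP.m-n≡m⊖n a b) (trans (ℤP.⊖-< a<b) (neg-positive (ℕP.m<n⇒0<n∸m a<b))))
  where
  neg-positive : ∀ {d} → 0 < d → ℤ.- (+ d) ≡ -[1+ (d ∸ 1) ]
  neg-positive {suc d} _ = refl

invPochSub-zero : ∀ a → invPochSub a 0 ≡ invPoch a
invPochSub-zero a = invPochSub-≤ {a} z≤n

invPochSub-suc : ∀ a b → invPochSub (suc a) (suc b) ≡ invPochSub a b
invPochSub-suc a b = cong recipPoch (begin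
  + suc a ℤ.- + suc b  ≡⟨ ℤP.m-n≡m⊖n (suc a) (suc b) ⟩
  suc a ℤ.⊖ suc b      ≡⟨ ℤP.[1+m]⊖[1+n]≡m⊖n a b ⟩
  a ℤ.⊖ b              ≡⟨ ℤP.m-n≡m⊖n a b ⟨
  + a ℤ.- + b          ∎)
  where open ≡-Reasoning

invPochSub-+ : ∀ k i → invPochSub (k ℕ.+ i) i ≡ invPoch k
invPochSub-+ k i = trans (invPochSub-≤ (ℕP.m≤n+m i k)) (cong invPoch (ℕP.m+n∸n≡m k i))

-- For k = 0 both sides vanish: 1/(q)_{-1} = 0 and 1 - q^0 = 0.
invPochSub-+-suc : ∀ k i → invPochSub (k ℕ.+ i) (suc i) ≈ᵖ invPoch k *ᵖ (1ᵖ -ᵖ qpow k)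
invPochSub-+-suc zero i
  rewrite invPochSub-> {i} {suc i} ℕP.≤-refl =
    ≈-sym (≈-trans (*-cong (≈-refl {1ᵖ}) 1ᵖ-qpow0≈0ᵖ) (zeroʳ 1ᵖ))
invPochSub-+-suc (suc k) i
  rewrite invPochSub-≤ {suc k ℕ.+ i} {suc i} (s≤s (ℕP.m≤n+m i k)) | ℕP.m+n∸n≡m k i = invPoch-pred (suc k) refl

pentagonal : ℕ → ℕ
pentagonal j = (j ℕ.* (3 ℕ.* j ∸ 1)) / 2

tripleTriangular : ℕ → ℕ
tripleTriangular zero    = 0
tripleTriangular (suc i) = tripleTriangular i ℕ.+ 3 ℕ.* suc i

tripleTriangular-*2 : ∀ i → tripleTriangular i ℕ.* 2 ≡ 3 ℕ.* i ℕ.* suc i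
tripleTriangular-*2 zero    = refl
tripleTriangular-*2 (suc i) = begin
  (tripleTriangular i ℕ.+ 3 ℕ.* suc i) ℕ.* 2     ≡⟨ ℕP.*-distribʳ-+ 2 (tripleTriangular i) (3 ℕ.* suc i) ⟩
  tripleTriangular i ℕ.* 2 ℕ.+ 3 ℕ.* suc i ℕ.* 2 ≡⟨ cong (ℕ._+ 3 ℕ.* suc i ℕ.* 2) (tripleTriangular-*2 i) ⟩
  3 ℕ.* i ℕ.* suc i ℕ.+ 3 ℕ.* suc i ℕ.* 2        ≡⟨ ℕ-Solver.solve (i ∷ []) ⟩
  3 ℕ.* suc i ℕ.* suc (suc i)                    ∎
  where open ≡-Reasoning

pentagonal-suc : ∀ i → pentagonal (suc i) ≡ tripleTriangular i ℕ.+ suc i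
pentagonal-suc i = trans (cong (_/ 2) double) (m*n/n≡m (tripleTriangular i ℕ.+ suc i) 2)
  where
  open ≡-Reasoning
  double : suc i ℕ.* (3 ℕ.* suc i ∸ 1) ≡ (tripleTriangular i ℕ.+ suc i) ℕ.* 2
  double = begin
    suc i ℕ.* (i ℕ.+ suc (i ℕ.+ suc (i ℕ.+ 0)))  ≡⟨ ℕ-Solver.solve (i ∷ []) ⟩
    3 ℕ.* i ℕ.* suc i ℕ.+ suc i ℕ.* 2            ≡⟨ cong (ℕ._+ suc i ℕ.* 2) (sym (tripleTriangular-*2 i)) ⟩
    tripleTriangular i ℕ.* 2 ℕ.+ suc i ℕ.* 2     ≡⟨ sym (ℕP.*-distribʳ-+ 2 (tripleTriangular i) (suc i)) ⟩
    (tripleTriangular i ℕ.+ suc i) ℕ.* 2         ∎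

-- The pentagonal sum and its telescoping recurrence

sign : ℕ → ℤ
sign j = (ℤ.- ℤ.1ℤ) ℤ.^ j

sign-suc-·ᵖ : ∀ j f → sign (suc j) ·ᵖ f ≈ᵖ negᵖ (const (sign j)) *ᵖ f
sign-suc-·ᵖ j f = ≈-trans (·ᵖ≈const*ᵖ (sign (suc j)) f)
  (*-cong (≈-trans (≡⇒≈ᵖ (cong const (ℤP.-1*i≡-i (sign j)))) (const-neg (sign j))) (≈-refl {f}))

weight : ℕ → PS
weight zero    = 1ᵖ
weight (suc i) = sign (suc i) ·ᵖ ((1ᵖ +ᵖ qpow (suc i)) *ᵖ qpow (pentagonal (suc i)))

summand : ℕ → ℕ → ℕ → PS
summand M n j =
  weight j *ᵖ (invPochSub M j *ᵖ invPoch (M ℕ.+ j) *ᵖ invPochSub n j *ᵖ invPoch (n ℕ.+ j))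

pentagonalSum : ℕ → ℕ → PS
pentagonalSum M n = sumPS n (summand M n)

antidifference : ℕ → ℕ → ℕ → PS
antidifference m n zero    = 0ᵖ
antidifference m n (suc i) = sign (suc i) ·ᵖ (qpow (tripleTriangular i) *ᵖ
  (invPochSub m i *ᵖ invPoch (suc m ℕ.+ i) *ᵖ invPochSub n (suc i) *ᵖ invPoch (n ℕ.+ i)))

stepFactor : ℕ → ℕ → PS
stepFactor m n = (1ᵖ -ᵖ qpow (suc m)) *ᵖ (1ᵖ -ᵖ qpow (suc m ℕ.+ n))

summand-zero : ∀ M n → summand M n 0 ≈ᵖ invPoch M *ᵖ invPoch M *ᵖ invPoch n *ᵖ invPoch n
summand-zero M n = ≈-trans (*-cong (≈-refl {1ᵖ}) (*-cong (*-cong (*-cong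
    (≡⇒≈ᵖ (invPochSub-zero M)) (≡⇒≈ᵖ (cong invPoch (ℕP.+-identityʳ M))))
    (≡⇒≈ᵖ (invPochSub-zero n))) (≡⇒≈ᵖ (cong invPoch (ℕP.+-identityʳ n)))))
  (*-identityˡ (invPoch M *ᵖ invPoch M *ᵖ invPoch n *ᵖ invPoch n))

summand-vanishes : ∀ {m} n j → m < j → summand m n j ≈ᵖ 0ᵖ
summand-vanishes {m} n j m<j = vanishing-*ᵖʳ (weight j)
  (vanishing-*ᵖˡ (invPoch (n ℕ.+ j)) (vanishing-*ᵖˡ (invPochSub n j)
    (vanishing-*ᵖˡ (invPoch (m ℕ.+ j)) (≡⇒≈ᵖ (invPochSub-> m<j)))))

antidifference-vanishes : ∀ m n i → m < i ⊎ n ≤ i → antidifference m n (suc i) ≈ᵖ 0ᵖ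
antidifference-vanishes m n i m<i⊎n≤i =
  vanishing-·ᵖ (sign (suc i)) (vanishing-*ᵖʳ (qpow (tripleTriangular i)) (product≈0 m<i⊎n≤i))
  where
  product≈0 : m < i ⊎ n ≤ i →
    invPochSub m i *ᵖ invPoch (suc m ℕ.+ i) *ᵖ invPochSub n (suc i) *ᵖ invPoch (n ℕ.+ i) ≈ᵖ 0ᵖ
  product≈0 (inj₁ m<i) = vanishing-*ᵖˡ (invPoch (n ℕ.+ i)) (vanishing-*ᵖˡ (invPochSub n (suc i))
    (vanishing-*ᵖˡ (invPoch (suc m ℕ.+ i)) (≡⇒≈ᵖ (invPochSub-> m<i))))
  product≈0 (inj₂ n≤i) = vanishing-*ᵖˡ (invPoch (n ℕ.+ i))
    (vanishing-*ᵖʳ (invPochSub m i *ᵖ invPoch (suc m ℕ.+ i)) (≡⇒≈ᵖ (invPochSub-> (s≤s n≤i))))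

summand-telescopes-vanishing : ∀ m n i → m < i →
  summand m n (suc i) -ᵖ stepFactor m n *ᵖ summand (suc m) n (suc i)
    ≈ᵖ qpow (suc m) *ᵖ (antidifference m n (suc (suc i)) -ᵖ antidifference m n (suc i))
summand-telescopes-vanishing m n i m<i = ≈-trans
  (-ᵖ-cong (summand-vanishes n (suc i) (ℕP.m<n⇒m<1+n m<i))
           (*-cong (≈-refl {stepFactor m n}) (summand-vanishes n (suc i) (s≤s m<i))))
  (≈-trans (solve 2 (λ p x → :0 :- p :* :0 := x :* (:0 :- :0))
                  ≈-refl (stepFactor m n) (qpow (suc m)))
           (≈-sym (*-cong (≈-refl {qpow (suc m)})
                          (-ᵖ-cong (antidifference-vanishes m n (suc i) (inj₁ (ℕP.m<n⇒m<1+n m<i)))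
                                   (antidifference-vanishes m n i (inj₁ m<i))))))

telescoping-identity-zero : ∀ Z Q A C →
  A *ᵖ (1ᵖ -ᵖ Z) *ᵖ (A *ᵖ (1ᵖ -ᵖ Z)) *ᵖ C *ᵖ C
    -ᵖ (1ᵖ -ᵖ Z) *ᵖ (1ᵖ -ᵖ Z *ᵖ Q) *ᵖ (A *ᵖ A *ᵖ C *ᵖ C)
    ≈ᵖ Z *ᵖ (negᵖ 1ᵖ *ᵖ (1ᵖ *ᵖ (A *ᵖ (1ᵖ -ᵖ Z) *ᵖ A *ᵖ (C *ᵖ (1ᵖ -ᵖ Q)) *ᵖ C)) -ᵖ 0ᵖ)
telescoping-identity-zero = solve 4 (λ Z Q A C →
  A :* (:1 :- Z) :* (A :* (:1 :- Z)) :* C :* C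
    :- (:1 :- Z) :* (:1 :- Z :* Q) :* (A :* A :* C :* C)
    := Z :* (:- :1 :* (:1 :* (A :* (:1 :- Z) :* A :* (C :* (:1 :- Q)) :* C)) :- :0))
  ≈-refl

summand-telescopes-zero : ∀ m n →
  summand m n 0 -ᵖ stepFactor m n *ᵖ summand (suc m) n 0
    ≈ᵖ qpow (suc m) *ᵖ (antidifference m n 1 -ᵖ antidifference m n 0)
summand-telescopes-zero m n = ≈-trans
  (-ᵖ-cong (≈-trans (summand-zero m n) (*-cong (*-cong (*-cong invPoch-m invPoch-m) (≈-refl {C})) (≈-refl {C})))
           (*-cong (*-cong (≈-refl {1ᵖ -ᵖ Z}) (1ᵖ-ᵖ-cong (qpow-+ (suc m) n))) (summand-zero (suc m) n)))
  (≈-trans (telescoping-identity-zero Z Q A C)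
  (≈-sym (*-cong (≈-refl {Z}) (-ᵖ-cong antidifference-1 (≈-refl {0ᵖ})))))
  where
  Z Q A C : PS
  Z = qpow (suc m)
  Q = qpow n
  A = invPoch (suc m)
  C = invPoch n
  invPoch-m : invPoch m ≈ᵖ A *ᵖ (1ᵖ -ᵖ Z)
  invPoch-m = invPoch-pred (suc m) refl
  invPochSub-n-1 : invPochSub n 1 ≈ᵖ C *ᵖ (1ᵖ -ᵖ Q)
  invPochSub-n-1 = subst (λ a → invPochSub a 1 ≈ᵖ C *ᵖ (1ᵖ -ᵖ Q)) (ℕP.+-identityʳ n) (invPochSub-+-suc n 0)
  antidifference-1 : antidifference m n 1
    ≈ᵖ negᵖ 1ᵖ *ᵖ (1ᵖ *ᵖ (A *ᵖ (1ᵖ -ᵖ Z) *ᵖ A *ᵖ (C *ᵖ (1ᵖ -ᵖ Q)) *ᵖ C))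
  antidifference-1 = ≈-trans (sign-suc-·ᵖ 0 _) (*-cong (≈-refl {negᵖ 1ᵖ}) (*-cong qpow0≈1ᵖ
    (*-cong (*-cong (*-cong (≈-trans (≡⇒≈ᵖ (invPochSub-zero m)) invPoch-m)
                            (≡⇒≈ᵖ (cong invPoch (ℕP.+-identityʳ (suc m)))))
                    invPochSub-n-1)
            (≡⇒≈ᵖ (cong invPoch (ℕP.+-identityʳ n))))))

-- Cancelling S E A B C D, this is the polynomial identity
-- Y (1 + Y) ((1 - U)(1 - U Y²) - (1 - U Y)(1 - U V Y²)) = - U Y (Y³ (1 - U)(1 - V) + (1 - U Y²)(1 - V Y²)).
telescoping-identity : ∀ S E Y U V A B C D →
  S *ᵖ ((1ᵖ +ᵖ Y) *ᵖ (E *ᵖ Y)) *ᵖ (A *ᵖ (1ᵖ -ᵖ U) *ᵖ (B *ᵖ (1ᵖ -ᵖ U *ᵖ Y *ᵖ Y)) *ᵖ C *ᵖ D)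
    -ᵖ (1ᵖ -ᵖ U *ᵖ Y) *ᵖ (1ᵖ -ᵖ U *ᵖ Y *ᵖ (V *ᵖ Y)) *ᵖ (S *ᵖ ((1ᵖ +ᵖ Y) *ᵖ (E *ᵖ Y)) *ᵖ (A *ᵖ B *ᵖ C *ᵖ D))
  ≈ᵖ U *ᵖ Y *ᵖ (negᵖ S *ᵖ (E *ᵖ (Y *ᵖ (Y *ᵖ Y)) *ᵖ (A *ᵖ (1ᵖ -ᵖ U) *ᵖ B *ᵖ (C *ᵖ (1ᵖ -ᵖ V)) *ᵖ D))
                 -ᵖ S *ᵖ (E *ᵖ (A *ᵖ (B *ᵖ (1ᵖ -ᵖ U *ᵖ Y *ᵖ Y)) *ᵖ C *ᵖ (D *ᵖ (1ᵖ -ᵖ V *ᵖ Y *ᵖ Y)))))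
telescoping-identity = solve 9 (λ S E Y U V A B C D →
  S :* ((:1 :+ Y) :* (E :* Y)) :* (A :* (:1 :- U) :* (B :* (:1 :- U :* Y :* Y)) :* C :* D)
    :- (:1 :- U :* Y) :* (:1 :- U :* Y :* (V :* Y)) :* (S :* ((:1 :+ Y) :* (E :* Y)) :* (A :* B :* C :* D))
  := U :* Y :* (:- S :* (E :* (Y :* (Y :* Y)) :* (A :* (:1 :- U) :* B :* (C :* (:1 :- V)) :* D))
                 :- S :* (E :* (A :* (B :* (:1 :- U :* Y :* Y)) :* C :* (D :* (:1 :- V :* Y :* Y))))))
  ≈-refl

-- With m = k + i and n = l + (i + 1), each 1/(q)_· factor is A, B, C or D times a polynomial in U, V, Y.
summand-telescopes-suc : ∀ k i l → let m = k ℕ.+ i ; n = l ℕ.+ suc i in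
  summand m n (suc i) -ᵖ stepFactor m n *ᵖ summand (suc m) n (suc i)
    ≈ᵖ qpow (suc m) *ᵖ (antidifference m n (suc (suc i)) -ᵖ antidifference m n (suc i))
summand-telescopes-suc k i l =
  ≈-trans (-ᵖ-cong summand-m≈ (*-cong stepFactor≈ summand-sm≈))
    (≈-trans (telescoping-identity S E Y U V A B C D)
      (≈-sym (*-cong UY (-ᵖ-cong antidifference-j+1≈ antidifference-j≈))))
  where
  m n : ℕ
  m = k ℕ.+ i
  n = l ℕ.+ suc i
  S E Y U V A B C D : PS
  S = const (sign (suc i))
  E = qpow (tripleTriangular i)
  Y = qpow (suc i)
  U = qpow k
  V = qpow l
  A = invPoch k
  B = invPoch (suc m ℕ.+ suc i)
  C = invPoch l
  D = invPoch (n ℕ.+ suc i)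

  UY : qpow (suc m) ≈ᵖ U *ᵖ Y
  UY = qpow-split k (suc i) (sym (ℕP.+-suc k i))
  UYY : qpow (suc m ℕ.+ suc i) ≈ᵖ U *ᵖ Y *ᵖ Y
  UYY = ≈-trans (qpow-+ (suc m) (suc i)) (*-cong UY (≈-refl {Y}))
  VY : qpow n ≈ᵖ V *ᵖ Y
  VY = qpow-+ l (suc i)
  VYY : qpow (n ℕ.+ suc i) ≈ᵖ V *ᵖ Y *ᵖ Y
  VYY = ≈-trans (qpow-+ n (suc i)) (*-cong VY (≈-refl {Y}))

  weight≈ : weight (suc i) ≈ᵖ S *ᵖ ((1ᵖ +ᵖ Y) *ᵖ (E *ᵖ Y))
  weight≈ = ≈-trans (·ᵖ≈const*ᵖ (sign (suc i)) ((1ᵖ +ᵖ Y) *ᵖ qpow (pentagonal (suc i))))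
    (*-cong (≈-refl {S}) (*-cong (≈-refl {1ᵖ +ᵖ Y}) (qpow-split (tripleTriangular i) (suc i) (pentagonal-suc i))))
  stepFactor≈ : stepFactor m n ≈ᵖ (1ᵖ -ᵖ U *ᵖ Y) *ᵖ (1ᵖ -ᵖ U *ᵖ Y *ᵖ (V *ᵖ Y))
  stepFactor≈ = *-cong (1ᵖ-ᵖ-cong UY) (1ᵖ-ᵖ-cong (≈-trans (qpow-+ (suc m) n) (*-cong UY VY)))

  invPochSub-sm-j : invPochSub (suc m) (suc i) ≈ᵖ A
  invPochSub-sm-j = ≡⇒≈ᵖ (trans (invPochSub-suc m i) (invPochSub-+ k i))
  invPochSub-n-j : invPochSub n (suc i) ≈ᵖ C
  invPochSub-n-j = ≡⇒≈ᵖ (invPochSub-+ l (suc i))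
  invPoch-m+j : invPoch (m ℕ.+ suc i) ≈ᵖ B *ᵖ (1ᵖ -ᵖ U *ᵖ Y *ᵖ Y)
  invPoch-m+j = ≈-trans (invPoch-pred (suc m ℕ.+ suc i) refl) (*-cong (≈-refl {B}) (1ᵖ-ᵖ-cong UYY))
  invPoch-sm+i : invPoch (suc m ℕ.+ i) ≈ᵖ B *ᵖ (1ᵖ -ᵖ U *ᵖ Y *ᵖ Y)
  invPoch-sm+i = ≈-trans (invPoch-pred (suc m ℕ.+ suc i) (sym (ℕP.+-suc (suc m) i)))
                         (*-cong (≈-refl {B}) (1ᵖ-ᵖ-cong UYY))
  invPoch-n+i : invPoch (n ℕ.+ i) ≈ᵖ D *ᵖ (1ᵖ -ᵖ V *ᵖ Y *ᵖ Y)
  invPoch-n+i = ≈-trans (invPoch-pred (n ℕ.+ suc i) (sym (ℕP.+-suc n i))) (*-cong (≈-refl {D}) (1ᵖ-ᵖ-cong VYY))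

  summand-m≈ : summand m n (suc i)
    ≈ᵖ S *ᵖ ((1ᵖ +ᵖ Y) *ᵖ (E *ᵖ Y)) *ᵖ (A *ᵖ (1ᵖ -ᵖ U) *ᵖ (B *ᵖ (1ᵖ -ᵖ U *ᵖ Y *ᵖ Y)) *ᵖ C *ᵖ D)
  summand-m≈ = *-cong weight≈
    (*-cong (*-cong (*-cong (invPochSub-+-suc k i) invPoch-m+j) invPochSub-n-j) (≈-refl {D}))
  summand-sm≈ : summand (suc m) n (suc i) ≈ᵖ S *ᵖ ((1ᵖ +ᵖ Y) *ᵖ (E *ᵖ Y)) *ᵖ (A *ᵖ B *ᵖ C *ᵖ D)
  summand-sm≈ = *-cong weight≈
    (*-cong (*-cong (*-cong invPochSub-sm-j (≈-refl {B})) invPochSub-n-j) (≈-refl {D}))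
  antidifference-j+1≈ : antidifference m n (suc (suc i))
    ≈ᵖ negᵖ S *ᵖ (E *ᵖ (Y *ᵖ (Y *ᵖ Y)) *ᵖ (A *ᵖ (1ᵖ -ᵖ U) *ᵖ B *ᵖ (C *ᵖ (1ᵖ -ᵖ V)) *ᵖ D))
  antidifference-j+1≈ = ≈-trans (sign-suc-·ᵖ (suc i) _) (*-cong (≈-refl {negᵖ S})
    (*-cong (≈-trans (qpow-+ (tripleTriangular i) (3 ℕ.* suc i)) (*-cong (≈-refl {E}) (qpow-3* (suc i))))
            (*-cong (*-cong (*-cong (invPochSub-+-suc k i) (≈-refl {B})) (invPochSub-+-suc l (suc i)))
                    (≈-refl {D}))))
  antidifference-j≈ : antidifference m n (suc i)
    ≈ᵖ S *ᵖ (E *ᵖ (A *ᵖ (B *ᵖ (1ᵖ -ᵖ U *ᵖ Y *ᵖ Y)) *ᵖ C *ᵖ (D *ᵖ (1ᵖ -ᵖ V *ᵖ Y *ᵖ Y))))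
  antidifference-j≈ = ≈-trans (·ᵖ≈const*ᵖ (sign (suc i)) _) (*-cong (≈-refl {S}) (*-cong (≈-refl {E})
    (*-cong (*-cong (*-cong (≡⇒≈ᵖ (invPochSub-+ k i)) invPoch-sm+i) invPochSub-n-j) invPoch-n+i)))

summand-telescopes : ∀ m n j → j ≤ n →
  summand m n j -ᵖ stepFactor m n *ᵖ summand (suc m) n j
    ≈ᵖ qpow (suc m) *ᵖ (antidifference m n (suc j) -ᵖ antidifference m n j)
summand-telescopes m n zero    _   = summand-telescopes-zero m n
summand-telescopes m n (suc i) j≤n with m ℕ.<? i
... | yes m<i = summand-telescopes-vanishing m n i m<i
... | no  m≮i = at-offsets (sym (ℕP.m∸n+n≡m (ℕP.≮⇒≥ m≮i))) (sym (ℕP.m∸n+n≡m j≤n))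
  where
  at-offsets : ∀ {m n k l} → m ≡ k ℕ.+ i → n ≡ l ℕ.+ suc i →
    summand m n (suc i) -ᵖ stepFactor m n *ᵖ summand (suc m) n (suc i)
      ≈ᵖ qpow (suc m) *ᵖ (antidifference m n (suc (suc i)) -ᵖ antidifference m n (suc i))
  at-offsets {k = k} {l} refl refl = summand-telescopes-suc k i l

pentagonalSum-step : ∀ m n → pentagonalSum m n ≈ᵖ stepFactor m n *ᵖ pentagonalSum (suc m) n
pentagonalSum-step m n = -ᵖ≈0ᵖ⇒≈ᵖ (begin
    pentagonalSum m n -ᵖ stepFactor m n *ᵖ pentagonalSum (suc m) n
  ≈⟨ sumPS-linear n (stepFactor m n) (summand m n) (summand (suc m) n) ⟨
    sumPS n (λ j → summand m n j -ᵖ stepFactor m n *ᵖ summand (suc m) n j)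
  ≈⟨ sumPS-cong n (summand-telescopes m n) ⟩
    sumPS n (λ j → qpow (suc m) *ᵖ (antidifference m n (suc j) -ᵖ antidifference m n j))
  ≈⟨ sumPS-telescoping n (qpow (suc m)) (antidifference m n) ⟩
    qpow (suc m) *ᵖ (antidifference m n (suc n) -ᵖ 0ᵖ)
  ≈⟨ vanishing-*ᵖʳ (qpow (suc m))
       (≈-trans (-ᵖ-cong (antidifference-vanishes m n n (inj₂ ℕP.≤-refl)) (≈-refl {0ᵖ}))
                (coeffwise λ _ → refl)) ⟩
    0ᵖ
  ∎)
  where open PS-Reasoning

pentagonalSum-closedForm : ∀ M n → pentagonalSum M n ≈ᵖ invPoch M *ᵖ invPoch n *ᵖ invPoch (M ℕ.+ n)
pentagonalSum-closedForm zero n = begin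
    pentagonalSum 0 n
  ≈⟨ sumPS-head n (summand 0 n) (λ i → summand-vanishes n (suc i) (s≤s z≤n)) ⟩
    summand 0 n 0
  ≈⟨ summand-zero 0 n ⟩
    1ᵖ *ᵖ 1ᵖ *ᵖ invPoch n *ᵖ invPoch n
  ≈⟨ solve 1 (λ c → :1 :* :1 :* c :* c := :1 :* c :* c) ≈-refl (invPoch n) ⟩
    1ᵖ *ᵖ invPoch n *ᵖ invPoch n
  ∎
  where
  open PS-Reasoning
pentagonalSum-closedForm (suc m) n = begin
    pentagonalSum (suc m) n
  ≈⟨ ≈-trans (*-cong (*-cong (geom-*ᵖ-1-qpow m) (geom-*ᵖ-1-qpow (m ℕ.+ n))) (≈-refl {pentagonalSum (suc m) n}))
             (solve 1 (λ s → :1 :* :1 :* s := s) ≈-refl (pentagonalSum (suc m) n)) ⟨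
    G₁ *ᵖ D₁ *ᵖ (G₂ *ᵖ D₂) *ᵖ pentagonalSum (suc m) n
  ≈⟨ solve 5 (λ g₁ d₁ g₂ d₂ s → g₁ :* d₁ :* (g₂ :* d₂) :* s := g₁ :* g₂ :* (d₁ :* d₂ :* s))
           ≈-refl G₁ D₁ G₂ D₂ (pentagonalSum (suc m) n) ⟩
    G₁ *ᵖ G₂ *ᵖ (stepFactor m n *ᵖ pentagonalSum (suc m) n)
  ≈⟨ *-cong (≈-refl {G₁ *ᵖ G₂}) (≈-trans (≈-sym (pentagonalSum-step m n)) (pentagonalSum-closedForm m n)) ⟩
    G₁ *ᵖ G₂ *ᵖ (invPoch m *ᵖ invPoch n *ᵖ invPoch (m ℕ.+ n))
  ≈⟨ solve 5 (λ g₁ g₂ a c b → g₁ :* g₂ :* (a :* c :* b) := a :* g₁ :* c :* (b :* g₂))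
           ≈-refl G₁ G₂ (invPoch m) (invPoch n) (invPoch (m ℕ.+ n)) ⟩
    invPoch (suc m) *ᵖ invPoch n *ᵖ invPoch (suc m ℕ.+ n)
  ∎
  where
  open PS-Reasoning
  G₁ G₂ D₁ D₂ : PS
  G₁ = geom m
  G₂ = geom (m ℕ.+ n)
  D₁ = 1ᵖ -ᵖ qpow (suc m)
  D₂ = 1ᵖ -ᵖ qpow (suc m ℕ.+ n)

baileySummand≈poch*summand : ∀ M n j →
  α M j *ᵖ invPochSub n j *ᵖ invPoch (n ℕ.+ j) ≈ᵖ poch M *ᵖ summand M n j
baileySummand≈poch*summand M n zero = begin
    invPoch M *ᵖ invPochSub n 0 *ᵖ invPoch (n ℕ.+ 0)
  ≈⟨ *-cong (*-cong (≈-refl {invPoch M}) (≡⇒≈ᵖ (invPochSub-zero n)))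
            (≡⇒≈ᵖ (cong invPoch (ℕP.+-identityʳ n))) ⟩
    invPoch M *ᵖ C *ᵖ C
  ≈⟨ poch-invPoch-cancel M (invPoch M *ᵖ C *ᵖ C) ⟨
    poch M *ᵖ (invPoch M *ᵖ (invPoch M *ᵖ C *ᵖ C))
  ≈⟨ *-cong (≈-refl {poch M}) (solve 2 (λ i c → i :* (i :* c :* c) := i :* i :* c :* c) ≈-refl (invPoch M) C) ⟩
    poch M *ᵖ (invPoch M *ᵖ invPoch M *ᵖ C *ᵖ C)
  ≈⟨ *-cong (≈-refl {poch M}) (summand-zero M n) ⟨
    poch M *ᵖ summand M n 0
  ∎
  where
  open PS-Reasoning
  C : PS
  C = invPoch n
baileySummand≈poch*summand M n (suc i) = ≈-trans
  (*-cong (*-cong (·ᵖ≈const*ᵖ (sign j) (P *ᵖ O *ᵖ Q *ᵖ a *ᵖ b)) (≈-refl {c})) (≈-refl {d}))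
  (≈-trans (solve 8 (λ s P O Q a b c d →
                     s :* (P :* O :* Q :* a :* b) :* c :* d := P :* (s :* (O :* Q) :* (a :* b :* c :* d)))
                  ≈-refl (const (sign j)) P O Q a b c d)
  (≈-sym (*-cong (≈-refl {P}) (*-cong (·ᵖ≈const*ᵖ (sign j) (O *ᵖ Q)) (≈-refl {a *ᵖ b *ᵖ c *ᵖ d})))))
  where
  j : ℕ
  j = suc i
  P O Q a b c d : PS
  P = poch M
  O = 1ᵖ +ᵖ qpow j
  Q = qpow (pentagonal j)
  a = invPochSub M j
  b = invPoch (M ℕ.+ j)
  c = invPochSub n j
  d = invPoch (n ℕ.+ j)

lemma3 : (M n k : ℕ) → β M n k ≡ baileyRHS M n k
lemma3 M n = coeff (≈-sym (begin
    baileyRHS M n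
  ≈⟨ sumPS-cong n (λ j _ → baileySummand≈poch*summand M n j) ⟩
    sumPS n (λ j → poch M *ᵖ summand M n j)
  ≈⟨ sumPS-*ˡ n (poch M) (summand M n) ⟩
    poch M *ᵖ pentagonalSum M n
  ≈⟨ *-cong (≈-refl {poch M}) (pentagonalSum-closedForm M n) ⟩
    poch M *ᵖ (invPoch M *ᵖ invPoch n *ᵖ invPoch (M ℕ.+ n))
  ≈⟨ *-cong (≈-refl {poch M}) (*ᵖ-assoc (invPoch M) (invPoch n) (invPoch (M ℕ.+ n))) ⟩
    poch M *ᵖ (invPoch M *ᵖ (invPoch n *ᵖ invPoch (M ℕ.+ n)))
  ≈⟨ poch-invPoch-cancel M (invPoch n *ᵖ invPoch (M ℕ.+ n)) ⟩
    invPoch n *ᵖ invPoch (M ℕ.+ n)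
  ≡⟨ cong (λ t → invPoch n *ᵖ invPoch t) (ℕP.+-comm M n) ⟩
    β M n
  ∎))
  where open PS-Reasoning
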